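{- Let $\mathcal{I}$ be an instance of monotone 1-in-3 SAT with clauses $C_1,\ldots,C_m$ over variables $X_1,\ldots,X_n$, and let $(\mathcal{A},U,\mathsf{cost})$ be the min-cost popular instance input constructed from $\mathcal{I}$ as described in the context. Then every instance $(\mathcal{A}\cup\mathcal{B},E)$ (i.e. every choice of $\mathsf{copies}(b)\ge 0$ for $b\in U$) that admits a popular matching matching all people of $\mathcal{A}$ has cost at least $14m$.
   Context: Popular matchings: a preference instance is a bipartite graph $G=(\mathcal{A}\cup\mathcal{B},E)$ with $\mathcal{A}$ a set of people and $\mathcal{B}$ a set of items; each person ranks the items adjacent to her in order of preference; each item $b$ has a number $\mathsf{copies}(b)$ of copies. A matching $M$ assigns each person at most one acceptable item such that each item $b$ is assigned to at most $\mathsf{copies}(b)$ people; $M(a)$ is the item assigned to $a$. A person $a$ prefers $M$ to $M'$ if $a$ is matched in $M$ and unmatched in $M'$, or matched in both and prefers $M(a)$ to $M'(a)$. $M$ is more popular than $M'$ if more people prefer $M$ to $M'$ than prefer $M'$ to $M$; $M$ is popular if no matching is more popular than $M$. Min-cost popular instance problem: given a set $\mathcal{A}$ of people, each with a preference list over a universe $U$ of items, and a price $\mathsf{cost}(b)\ge 0$ for each $b\in U$, an instance is obtained by choosing integers $\mathsf{copies}(b)\ge 0$ for all $b\in U$; the item set $\mathcal{B}$ consists of the items with $\mathsf{copies}(b)>0$, each person's preference list is her original list restricted to these items (ranks being determined by the relative order among the present items, so e.g. the first present item is her top choice), and the cost of the instance is $\sum_{b\in U}\mathsf{copies}(b)\,\mathsf{cost}(b)$.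 Monotone 1-in-3 SAT: each clause consists of exactly 3 unnegated variables; the question is whether there is a truth assignment making exactly one literal true in every clause. Construction: for each clause $C_i=(X_{j_1}\vee X_{j_2}\vee X_{j_3})$ there are 9 people $a^i_1,\ldots,a^i_9$ and internal items $p^i_1,p^i_2,p^i_3,q^i$; for each variable $X_j$ there is a public item $u_j$. Preference lists (first choice, then second choice): $a^i_1: u_{j_1},u_{j_2}$; $a^i_2: u_{j_2},u_{j_3}$; $a^i_3: u_{j_1},u_{j_3}$; $a^i_4: u_{j_1},p^i_1$; $a^i_5: u_{j_2},p^i_2$; $a^i_6: u_{j_3},p^i_3$; $a^i_7: p^i_1,q^i$; $a^i_8: p^i_2,q^i$; $a^i_9: p^i_3,q^i$. $\mathcal{A}=\bigcup_i\{a^i_1,\ldots,a^i_9\}$, $U=\{u_1,\ldots,u_n\}\cup\bigcup_i\{p^i_1,p^i_2,p^i_3,q^i\}$, with $\mathsf{cost}(p^i_t)=1$, $\mathsf{cost}(q^i)=0$, $\mathsf{cost}(u_j)=3$. -}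

module Defs where

open import Data.Nat using (ℕ; zero; suc; _+_; _*_; _≤_; _<_; _<ᵇ_; _≤?_)
open import Data.Fin using (Fin; zero; suc) renaming (_≟_ to _≟F_)
open import Data.Bool using (Bool; true; false; if_then_else_)
open import Data.Maybe using (Maybe; just; nothing)
open import Data.List using (List; []; _∷_; _++_; map; filter; allFin; cartesianProduct; concatMap)
open import Data.Nat.ListAction using (sum)
open import Data.List.Membership.Propositional using (_∈_)
open import Data.Product using (_×_; _,_)
open import Relation.Nullary using (¬_; Dec; yes; no; does)
open import Relation.Binary.Definitions using (DecidableEquality)
open import Relation.Binary.PropositionalEquality using (_≡_; _≢_; refl; cong; cong₂)

-- People: a type P with the (duplicate-free) list of all people.
-- Items: a type I with decidable equality.
-- prefs a : the ORIGINAL preference list of a over the universe (best first).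
-- copies : number of copies of each item (0 = item absent).

module PopularDefs {P I : Set} (_≟_ : DecidableEquality I)
                   (people : List P) (prefs : P → List I) (copies : I → ℕ) where

  prefList : P → List I
  prefList a = filter (λ b → 1 ≤? copies b) (prefs a)

  rank : I → List I → ℕ
  rank b [] = zero
  rank b (c ∷ cs) = if does (b ≟ c) then zero else suc (rank b cs)

  count : (P → Bool) → ℕ
  count f = sum (map (λ a → if f a then 1 else 0) people)

  isAssignedTo : (P → Maybe I) → I → P → Bool
  isAssignedTo M b a with M a
  ... | nothing = false
  ... | just c = does (c ≟ b)

  record IsMatching (M : P → Maybe I) : Set where
    field
      acceptable : ∀ a b → M a ≡ just b → b ∈ prefList a
      capacity   : ∀ b → count (isAssignedTo M b) ≤ copies b

  prefers : P → (P → Maybe I) → (P → Maybe I) → Bool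
  prefers a M M' with M a | M' a
  ... | just b  | nothing = true
  ... | just b  | just b' = rank b (prefList a) <ᵇ rank b' (prefList a)
  ... | nothing | _       = false

  MorePopular : (P → Maybe I) → (P → Maybe I) → Set
  MorePopular M M' = count (λ a → prefers a M' M) < count (λ a → prefers a M M')

  record IsPopular (M : P → Maybe I) : Set where
    field
      matching : IsMatching M
      noBetter : ∀ M' → IsMatching M' → ¬ MorePopular M' M

  Perfect : (P → Maybe I) → Set
  Perfect M = ∀ a → M a ≢ nothing

Clause : ℕ → Set
Clause n = Fin n × Fin n × Fin n

DistinctClause : ∀ {n} → Clause n → Set
DistinctClause (j₁ , j₂ , j₃) = j₁ ≢ j₂ × j₂ ≢ j₃ × j₁ ≢ j₃

-- universe U of items: u j (public), p i t (t = 0,1,2 for p^i_1..p^i_3), q i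
data Item (n m : ℕ) : Set where
  u : Fin n → Item n m
  p : Fin m → Fin 3 → Item n m
  q : Fin m → Item n m

_≟I_ : ∀ {n m} → DecidableEquality (Item n m)
u j ≟I u j' with j ≟F j'
... | yes refl = yes refl
... | no ne = no λ { refl → ne refl }
u _ ≟I p _ _ = no λ ()
u _ ≟I q _ = no λ ()
p _ _ ≟I u _ = no λ ()
p i t ≟I p i' t' with i ≟F i' | t ≟F t'
... | yes refl | yes refl = yes refl
... | no ne | _ = no λ { refl → ne refl }
... | yes _ | no ne = no λ { refl → ne refl }
p _ _ ≟I q _ = no λ ()
q _ ≟I u _ = no λ ()
q _ ≟I p _ _ = no λ ()
q i ≟I q i' with i ≟F i'
... | yes refl = yes refl
... | no ne = no λ { refl → ne refl }

allItems : (n m : ℕ) → List (Item n m)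
allItems n m = map u (allFin n) ++ concatMap (λ i → map (p i) (allFin 3) ++ (q i ∷ [])) (allFin m)

cost : ∀ {n m} → Item n m → ℕ
cost (u _) = 3
cost (p _ _) = 1
cost (q _) = 0

instanceCost : (n m : ℕ) → (Item n m → ℕ) → ℕ
instanceCost n m copies = sum (map (λ b → copies b * cost b) (allItems n m))

-- people: a^i_{k+1} is (i , k) with k : Fin 9
Person : ℕ → Set
Person m = Fin m × Fin 9

allPeople : (m : ℕ) → List (Person m)
allPeople m = cartesianProduct (allFin m) (allFin 9)

p₁ p₂ p₃ : ∀ {n m} → Fin m → Item n m
p₁ i = p i zero
p₂ i = p i (suc zero)
p₃ i = p i (suc (suc zero))

prefsOf : ∀ {n m} → (Fin m → Clause n) → Person m → List (Item n m)
prefsOf C (i , k) with C i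
... | (j₁ , j₂ , j₃) = go k
  where
  go : Fin 9 → List _
  go zero = u j₁ ∷ u j₂ ∷ []
  go (suc zero) = u j₂ ∷ u j₃ ∷ []
  go (suc (suc zero)) = u j₁ ∷ u j₃ ∷ []
  go (suc (suc (suc zero))) = u j₁ ∷ p₁ i ∷ []
  go (suc (suc (suc (suc zero)))) = u j₂ ∷ p₂ i ∷ []
  go (suc (suc (suc (suc (suc zero))))) = u j₃ ∷ p₃ i ∷ []
  go (suc (suc (suc (suc (suc (suc zero)))))) = p₁ i ∷ q i ∷ []
  go (suc (suc (suc (suc (suc (suc (suc zero))))))) = p₂ i ∷ q i ∷ []
  go (suc (suc (suc (suc (suc (suc (suc (suc zero)))))))) = p₃ i ∷ q i ∷ []

AdmitsPerfectPopular : (n m : ℕ) → (Fin m → Clause n) → (Item n m → ℕ) → Set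
AdmitsPerfectPopular n m C copies =
  Σ (Person m → Maybe (Item n m)) λ M → IsPopular M × Perfect M
  where
  open PopularDefs _≟I_ (allPeople m) (prefsOf C) copies
  open import Data.Product using (Σ)

-- Idea.  Let M be such a matching.  Charge every person the price of the item
-- M gives her; as no item is assigned beyond its copies, the total charge is
-- at most the cost of the instance (`price-bound`).  It remains to charge at
-- least 14 inside each clause gadget.  The three people a₁, a₂, a₃ always
-- hold a public item and pay 3 each.  The gadget pairs (a₄,a₇), (a₅,a₈),
-- (a₆,a₉) pay at least 1 each, and at least 2 unless a₄ holds p₁ and a₇
-- holds q (and similarly for the other pairs).  In that exceptional case u_{j₁}
-- must be absent: otherwise a₄ could move up to u_{j₁} and a₇ up to p₁,
-- which would make a more popular matching (`no-promotion`, a general fact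
-- about popular matchings).  Since each of a₁, a₂, a₃ holds a copy of one of
-- its two variables, among any two pairs one pays at least 2, so the pairs
-- pay at least 1 + 2 + 2 and the gadget at least 9 + 5 = 14.

module Submission where

open import Defs
open import Data.Nat using (ℕ; suc; _+_; _*_; _≤_; _<_; _<ᵇ_; _≤?_; z≤n; s≤s)
open import Data.Nat.Properties
open import Data.Nat.ListAction using (sum)
open import Data.Nat.ListAction.Properties using (sum-++)
open import Data.Bool using (Bool; true; false; if_then_else_)
open import Data.Bool.Properties using (T-≡)
open import Data.Empty using (⊥; ⊥-elim)
open import Data.Fin using (Fin; #_) renaming (_≟_ to _≟F_)
open import Data.Maybe using (Maybe; just; nothing)
open import Data.Maybe.Properties using (just-injective)
open import Data.List using (List; []; _∷_; _++_; map; allFin; cartesianProduct; length)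
open import Data.List.Properties using (map-++; map-∘; map-cong; filter-accept; length-tabulate)
open import Data.List.Membership.Propositional using (_∈_; _∉_)
open import Data.List.Membership.Propositional.Properties
  using (∈-++⁺ˡ; ∈-++⁺ʳ; ∈-map⁺; ∈-concatMap⁺; ∈-allFin; ∈-cartesianProduct⁺; ∈-filter⁻)
open import Data.List.Relation.Unary.Any using (here; there)
import Data.List.Relation.Unary.Any as Any
import Data.List.Relation.Unary.All as All
open import Data.List.Relation.Unary.AllPairs using (_∷_)
open import Data.List.Relation.Unary.Unique.Propositional using (Unique)
import Data.List.Relation.Unary.Unique.Propositional.Properties as Unique
open import Data.Product using (∃; _×_; _,_; proj₁; proj₂)
open import Data.Product.Properties using (≡-dec)
open import Data.Sum using (_⊎_; inj₁; inj₂)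
import Data.Sum as Sum
open import Function using (_∘_; id)
open import Function.Bundles using (Equivalence)
open import Relation.Nullary using (¬_; Dec; yes; no; does)
open import Relation.Nullary.Decidable using (dec-true; dec-false)
open import Relation.Binary.Definitions using (DecidableEquality)
open import Relation.Binary.PropositionalEquality
open import Algebra.Properties.CommutativeSemigroup +-commutativeSemigroup using (interchange)
open import Data.Nat.Solver using (module +-*-Solver)

∑ : {A : Set} → List A → (A → ℕ) → ℕ
∑ l f = sum (map f l)

module _ {A : Set} where

  ∑-++ : ∀ xs ys (f : A → ℕ) → ∑ (xs ++ ys) f ≡ ∑ xs f + ∑ ys f
  ∑-++ xs ys f = trans (cong sum (map-++ f xs ys)) (sum-++ (map f xs) (map f ys))

  ∑-+ : ∀ (l : List A) f g → ∑ l (λ a → f a + g a) ≡ ∑ l f + ∑ l g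
  ∑-+ [] f g = refl
  ∑-+ (x ∷ l) f g = trans (cong (f x + g x +_) (∑-+ l f g)) (interchange (f x) (g x) (∑ l f) (∑ l g))

  ∑-zero : ∀ (l : List A) → ∑ l (λ _ → 0) ≡ 0
  ∑-zero [] = refl
  ∑-zero (x ∷ l) = ∑-zero l

  ∑-mono : ∀ (l : List A) {f g : A → ℕ} → (∀ a → f a ≤ g a) → ∑ l f ≤ ∑ l g
  ∑-mono [] h = z≤n
  ∑-mono (x ∷ l) h = +-mono-≤ (h x) (∑-mono l h)

  ∑-*ʳ : ∀ (l : List A) f c → ∑ l (λ a → f a * c) ≡ ∑ l f * c
  ∑-*ʳ [] f c = refl
  ∑-*ʳ (x ∷ l) f c = trans (cong (f x * c +_) (∑-*ʳ l f c)) (sym (*-distribʳ-+ c (f x) (∑ l f)))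

  ∑-lower : ∀ (l : List A) f c → (∀ a → c ≤ f a) → c * length l ≤ ∑ l f
  ∑-lower [] f c h = ≤-reflexive (*-zeroʳ c)
  ∑-lower (x ∷ l) f c h rewrite *-suc c (length l) = +-mono-≤ (h x) (∑-lower l f c h)

  ∑-member : ∀ {l : List A} {x} f → x ∈ l → f x ≤ ∑ l f
  ∑-member f (here refl) = m≤m+n _ _
  ∑-member {y ∷ l} f (there x∈l) = ≤-trans (∑-member f x∈l) (m≤n+m _ (f y))

∑-map : {A B : Set} (g : A → B) (l : List A) (f : B → ℕ) → ∑ (map g l) f ≡ ∑ l (f ∘ g)
∑-map g l f = cong sum (sym (map-∘ l))

module _ {A B : Set} where

  ∑-cartesian : ∀ (xs : List A) (ys : List B) f →
                ∑ (cartesianProduct xs ys) f ≡ ∑ xs (λ x → ∑ ys (λ y → f (x , y)))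
  ∑-cartesian [] ys f = refl
  ∑-cartesian (x ∷ xs) ys f =
    trans (∑-++ (map (x ,_) ys) _ f) (cong₂ _+_ (∑-map (x ,_) ys f) (∑-cartesian xs ys f))

  ∑-swap : ∀ (xs : List A) (ys : List B) (f : A → B → ℕ) →
           ∑ xs (λ x → ∑ ys (f x)) ≡ ∑ ys (λ y → ∑ xs (λ x → f x y))
  ∑-swap [] ys f = sym (∑-zero ys)
  ∑-swap (x ∷ xs) ys f =
    trans (cong (∑ ys (f x) +_) (∑-swap xs ys f)) (sym (∑-+ ys (f x) (λ y → ∑ xs (λ x' → f x' y))))

ι : Bool → ℕ
ι b = if b then 1 else 0

ι≤1 : ∀ b → ι b ≤ 1
ι≤1 true = ≤-refl
ι≤1 false = z≤n

indicators≤ : ∀ {b₁ b₂ b₃ b₄ v₁ v₂ v₃ v₄} → b₁ ≡ v₁ → b₂ ≡ v₂ → b₃ ≡ v₃ → b₄ ≡ v₄ →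
              ι v₁ + ι v₂ ≤ ι v₃ + ι v₄ → ι b₁ + ι b₂ ≤ ι b₃ + ι b₄
indicators≤ refl refl refl refl h = h

indicator≤ : ∀ {b₁ b₂ v₁ v₂} → b₁ ≡ v₁ → b₂ ≡ v₂ → ι v₁ ≤ ι v₂ → ι b₁ ≤ ι b₂
indicator≤ refl refl h = h

module _ {A : Set} (_≟_ : DecidableEquality A) where

  ∑-indicator-absent : ∀ (l : List A) {z} → z ∉ l → ∑ l (λ a → ι (does (a ≟ z))) ≡ 0
  ∑-indicator-absent [] z∉l = refl
  ∑-indicator-absent (y ∷ l) {z} z∉l
    rewrite dec-false (y ≟ z) (λ y≡z → z∉l (here (sym y≡z))) = ∑-indicator-absent l (z∉l ∘ there)

  ∑-indicator : ∀ (l : List A) {z} → Unique l → z ∈ l → ∑ l (λ a → ι (does (a ≟ z))) ≡ 1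
  ∑-indicator (y ∷ l) (y∉l ∷ _) (here refl)
    rewrite dec-true (y ≟ y) refl = cong suc (∑-indicator-absent l (λ y∈l → All.lookup y∉l y∈l refl))
  ∑-indicator (y ∷ l) {z} (y∉l ∷ l-unique) (there z∈l)
    rewrite dec-false (y ≟ z) (λ { refl → All.lookup y∉l z∈l refl }) = ∑-indicator l l-unique z∈l

<ᵇ-true : ∀ {m n} → m < n → (m <ᵇ n) ≡ true
<ᵇ-true m<n = Equivalence.to T-≡ (<⇒<ᵇ m<n)

<ᵇ-false : ∀ {m n} → ¬ m < n → (m <ᵇ n) ≡ false
<ᵇ-false {m} {n} m≮n with m <ᵇ n in eq
... | true = ⊥-elim (m≮n (<ᵇ⇒< m n (Equivalence.from T-≡ eq)))
... | false = refl

-- General facts about popular matchings in a preference instance whose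
-- people form the duplicate-free complete list `people`.

module PopularFacts {A B : Set} (_≟_ : DecidableEquality B) (_≟ᴬ_ : DecidableEquality A)
                    (people : List A) (people-unique : Unique people) (people-complete : ∀ a → a ∈ people)
                    (prefs : A → List B) (copies : B → ℕ) where

  open PopularDefs _≟_ people prefs copies

  Assignment : Set
  Assignment = A → Maybe B

  is : A → A → Bool
  is z a = does (a ≟ᴬ z)

  is-self : ∀ z → is z z ≡ true
  is-self z = dec-true (z ≟ᴬ z) refl

  is-other : ∀ {z a} → a ≢ z → is z a ≡ false
  is-other {z} {a} a≢z = dec-false (a ≟ᴬ z) a≢z

  is-sound : ∀ {z a} → is z a ≡ true → a ≡ z
  is-sound {z} {a} h with a ≟ᴬ z
  ... | yes a≡z = a≡z
  is-sound () | no _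

  -- Counting people: `count` sums indicators over the complete duplicate-free
  -- list, so every person is counted once

  count-is : ∀ z → count (is z) ≡ 1
  count-is z = ∑-indicator _≟ᴬ_ people people-unique (people-complete z)

  count-none : count (λ _ → false) ≡ 0
  count-none = ∑-zero people

  count-mono₂ : ∀ {f g h k : A → Bool} → (∀ a → ι (f a) + ι (g a) ≤ ι (h a) + ι (k a)) →
                count f + count g ≤ count h + count k
  count-mono₂ {f} {g} {h} {k} pointwise =
    subst₂ _≤_ (∑-+ people (ι ∘ f) (ι ∘ g)) (∑-+ people (ι ∘ h) (ι ∘ k)) (∑-mono people pointwise)

  count-mono : ∀ {f g : A → Bool} → (∀ a → ι (f a) ≤ ι (g a)) → count f ≤ count g
  count-mono pointwise = ∑-mono people pointwise

  count-witness : ∀ {f : A → Bool} → 1 ≤ count f → ∃ λ a → f a ≡ true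
  count-witness {f} = go people
    where
    go : ∀ l → 1 ≤ ∑ l (ι ∘ f) → ∃ λ a → f a ≡ true
    go (a ∷ l) pos with f a in fa
    ... | true = a , fa
    ... | false = go l pos

  count-two : ∀ {f : A → Bool} {x y} → x ≢ y → f x ≡ true → f y ≡ true → 2 ≤ count f
  count-two {f} {x} {y} x≢y fx fy =
    subst₂ _≤_ (cong₂ _+_ (count-is x) (count-is y)) (trans (cong (count f +_) count-none) (+-identityʳ _))
      (count-mono₂ pointwise)
    where
    pointwise : ∀ a → ι (is x a) + ι (is y a) ≤ ι (f a) + ι false
    pointwise a with a ≟ᴬ x
    ... | yes refl rewrite is-other x≢y | fx = ≤-refl
    ... | no _ with a ≟ᴬ y
    ...   | yes refl rewrite fy = ≤-refl
    ...   | no _ = z≤n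

  assigned-here : ∀ (M : Assignment) {a c} → M a ≡ just c → isAssignedTo M c a ≡ true
  assigned-here M {a} {c} eq with M a
  assigned-here M {c = c} refl | just .c = dec-true (c ≟ c) refl

  assigned-elsewhere : ∀ (M : Assignment) {a c d} → M a ≡ just d → d ≢ c → isAssignedTo M c a ≡ false
  assigned-elsewhere M {a} {c} eq d≢c with M a
  assigned-elsewhere M {c = c} {d} refl d≢c | just .d = dec-false (d ≟ c) d≢c

  unassigned : ∀ (M : Assignment) {a c} → M a ≡ nothing → isAssignedTo M c a ≡ false
  unassigned M {a} eq with M a
  unassigned M refl | nothing = refl

  assigned-agree : ∀ (M M' : Assignment) {a c} → M a ≡ M' a → isAssignedTo M c a ≡ isAssignedTo M' c a
  assigned-agree M M' {a} eq with M a | M' a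
  assigned-agree M M' refl | nothing | .nothing = refl
  assigned-agree M M' refl | just _ | .(just _) = refl

  assigned-sound : ∀ (M : Assignment) {a c} → isAssignedTo M c a ≡ true → M a ≡ just c
  assigned-sound M {a} {c} h with M a
  ... | just d with d ≟ c
  ...   | yes refl = refl
  assigned-sound M () | just d | no _
  assigned-sound M () | nothing

  prefers-just : ∀ (M₁ M₂ : Assignment) {a b₁ b₂} → M₁ a ≡ just b₁ → M₂ a ≡ just b₂ →
                 prefers a M₁ M₂ ≡ (rank b₁ (prefList a) <ᵇ rank b₂ (prefList a))
  prefers-just M₁ M₂ {a} e₁ e₂ with M₁ a | M₂ a
  prefers-just M₁ M₂ refl refl | just _ | just _ = refl

  prefers-same : ∀ (M₁ M₂ : Assignment) {a} → M₁ a ≡ M₂ a → prefers a M₁ M₂ ≡ false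
  prefers-same M₁ M₂ {a} eq with M₁ a | M₂ a
  prefers-same M₁ M₂ refl | nothing | _ = refl
  prefers-same M₁ M₂ {a} refl | just b | .(just b) = <ᵇ-false {rank b (prefList a)} (<-irrefl refl)

  present : ∀ {a c} → c ∈ prefList a → 1 ≤ copies c
  present {a} c∈list = proj₂ (∈-filter⁻ (λ b → 1 ≤? copies b) {xs = prefs a} c∈list)

  RanksAbove : A → B → B → Set
  RanksAbove a c d = c ∈ prefList a × rank c (prefList a) < rank d (prefList a)

  ranks-distinct : ∀ {a c d} → RanksAbove a c d → c ≢ d
  ranks-distinct (_ , lt) refl = <-irrefl refl lt

  top-two : ∀ {a c d rest} → prefs a ≡ c ∷ d ∷ rest → 1 ≤ copies c → 1 ≤ copies d → c ≢ d →
            RanksAbove a c d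
  top-two {a} {c} {d} {rest} eq c-present d-present c≢d
    rewrite eq | filter-accept (λ b → 1 ≤? copies b) {xs = d ∷ rest} c-present
              | filter-accept (λ b → 1 ≤? copies b) {xs = rest} d-present
              | dec-true (c ≟ c) refl | dec-false (d ≟ c) (c≢d ∘ sym) | dec-true (d ≟ d) refl
    = here refl , s≤s z≤n

  price : (B → ℕ) → Maybe B → ℕ
  price w nothing = 0
  price w (just c) = w c

  module _ {M : Assignment} (matching : IsMatching M) where
    open IsMatching matching

    assigned-present : ∀ {a c} → M a ≡ just c → c ∈ prefs a × 1 ≤ copies c
    assigned-present {a} {c} eq = ∈-filter⁻ (λ b → 1 ≤? copies b) (acceptable a c eq)

    two-choices : Perfect M → ∀ {a c d} → prefs a ≡ c ∷ d ∷ [] →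
                  (M a ≡ just c × 1 ≤ copies c) ⊎ (M a ≡ just d × 1 ≤ copies d)
    two-choices perfect {a} eq with M a in Ma
    ... | nothing = ⊥-elim (perfect a Ma)
    ... | just b with assigned-present Ma
    ...   | b∈prefs , b-present with subst (b ∈_) eq b∈prefs
    ...     | here refl = inj₁ (refl , b-present)
    ...     | there (here refl) = inj₂ (refl , b-present)

    price-bound : (items : List B) → (∀ c → c ∈ items) → (w : B → ℕ) →
                  ∑ people (λ a → price w (M a)) ≤ ∑ items (λ c → copies c * w c)
    price-bound items items-complete w = begin
      ∑ people (λ a → price w (M a))                                ≤⟨ ∑-mono people paid-by-item ⟩
      ∑ people (λ a → ∑ items (λ c → ι (isAssignedTo M c a) * w c)) ≡⟨ ∑-swap people items _ ⟩
      ∑ items (λ c → ∑ people (λ a → ι (isAssignedTo M c a) * w c)) ≡⟨ cong sum (map-cong per-item items) ⟩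
      ∑ items (λ c → count (isAssignedTo M c) * w c)                ≤⟨ ∑-mono items (λ c → *-monoˡ-≤ (w c) (capacity c)) ⟩
      ∑ items (λ c → copies c * w c)                                ∎
      where
      open ≤-Reasoning
      per-item : ∀ c → ∑ people (λ a → ι (isAssignedTo M c a) * w c) ≡ count (isAssignedTo M c) * w c
      per-item c = ∑-*ʳ people (λ a → ι (isAssignedTo M c a)) (w c)
      paid-by-item : ∀ a → price w (M a) ≤ ∑ items (λ c → ι (isAssignedTo M c a) * w c)
      paid-by-item a = price-of (M a) refl
        where
        price-of : ∀ mb → M a ≡ mb → price w mb ≤ ∑ items (λ c → ι (isAssignedTo M c a) * w c)
        price-of nothing _ = z≤n
        price-of (just c) Ma =
          subst (_≤ ∑ items (λ d → ι (isAssignedTo M d a) * w d))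
            (trans (cong (λ b → ι b * w c) (assigned-here M Ma)) (*-identityˡ (w c)))
            (∑-member (λ d → ι (isAssignedTo M d a) * w d) (items-complete c))

  -- No popular matching admits a promotion chain: if x holds b₂ but ranks the
  -- present item b₁ above it, and y holds b₃ but ranks b₂ above it, then
  -- moving x to b₁ and y to b₂ (and, when b₁ is full, unmatching one holder
  -- of b₁) yields a more popular matching: x and y gain, at most one loses.

  module _ {M : Assignment} (popular : IsPopular M) where
    open IsPopular popular
    open IsMatching matching

    module Promotion {x y : A} {b₁ b₂ b₃ : B} (Mx : M x ≡ just b₂) (My : M y ≡ just b₃) (b₃≢b₁ : b₃ ≢ b₁)
                     (x-ranks : RanksAbove x b₁ b₂) (y-ranks : RanksAbove y b₂ b₃)
                     (dropped : A → Bool) (dropped-hold-b₁ : ∀ a → dropped a ≡ true → M a ≡ just b₁)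
                     (few-dropped : count dropped ≤ 1)
                     (room : suc (count (isAssignedTo M b₁)) ≤ copies b₁ + count dropped) where

      b₁≢b₂ : b₁ ≢ b₂
      b₁≢b₂ = ranks-distinct x-ranks

      b₂≢b₃ : b₂ ≢ b₃
      b₂≢b₃ = ranks-distinct y-ranks

      x≢y : x ≢ y
      x≢y refl = b₂≢b₃ (just-injective (trans (sym Mx) My))

      relocate : ∀ {a} → Dec (a ≡ x) → Dec (a ≡ y) → Bool → Maybe B → Maybe B
      relocate (yes _) _ _ _ = just b₁
      relocate (no _) (yes _) _ _ = just b₂
      relocate (no _) (no _) true _ = nothing
      relocate (no _) (no _) false mb = mb

      M' : Assignment
      M' a = relocate (a ≟ᴬ x) (a ≟ᴬ y) (dropped a) (M a)

      data Role (a : A) (mb : Maybe B) : Set where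
        mover     : a ≡ x → mb ≡ just b₁ → Role a mb
        taker     : a ≡ y → mb ≡ just b₂ → Role a mb
        dropout   : a ≢ x → a ≢ y → dropped a ≡ true → mb ≡ nothing → Role a mb
        bystander : a ≢ x → a ≢ y → dropped a ≡ false → mb ≡ M a → Role a mb

      role : ∀ a → Role a (M' a)
      role a = classify (a ≟ᴬ x) (a ≟ᴬ y) (dropped a) refl
        where
        classify : (d₁ : Dec (a ≡ x)) (d₂ : Dec (a ≡ y)) (b : Bool) → dropped a ≡ b →
                   Role a (relocate d₁ d₂ b (M a))
        classify (yes a≡x) _ _ _ = mover a≡x refl
        classify (no a≢x) (yes a≡y) _ _ = taker a≡y refl
        classify (no a≢x) (no a≢y) true d = dropout a≢x a≢y d refl
        classify (no a≢x) (no a≢y) false d = bystander a≢x a≢y d refl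

      M'x : M' x ≡ just b₁
      M'x with role x
      ... | mover _ e = e
      ... | taker x≡y _ = ⊥-elim (x≢y x≡y)
      ... | dropout x≢x _ _ _ = ⊥-elim (x≢x refl)
      ... | bystander x≢x _ _ _ = ⊥-elim (x≢x refl)

      M'y : M' y ≡ just b₂
      M'y with role y
      ... | mover y≡x _ = ⊥-elim (x≢y (sym y≡x))
      ... | taker _ e = e
      ... | dropout _ y≢y _ _ = ⊥-elim (y≢y refl)
      ... | bystander _ y≢y _ _ = ⊥-elim (y≢y refl)

      dropped-x : dropped x ≡ false
      dropped-x with dropped x in d
      ... | true = ⊥-elim (b₁≢b₂ (just-injective (trans (sym (dropped-hold-b₁ x d)) Mx)))
      ... | false = refl

      dropped-y : dropped y ≡ false
      dropped-y with dropped y in d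
      ... | true = ⊥-elim (b₃≢b₁ (just-injective (trans (sym My) (dropped-hold-b₁ y d))))
      ... | false = refl

      acceptable' : ∀ a c → M' a ≡ just c → c ∈ prefList a
      acceptable' a c eq with role a
      ... | mover refl e = subst (_∈ prefList x) (just-injective (trans (sym e) eq)) (proj₁ x-ranks)
      ... | taker refl e = subst (_∈ prefList y) (just-injective (trans (sym e) eq)) (proj₁ y-ranks)
      ... | dropout _ _ _ e with () ← trans (sym eq) e
      ... | bystander _ _ _ e = acceptable a c (trans (sym e) eq)

      balance-b₁ : ∀ a → ι (isAssignedTo M' b₁ a) + ι (dropped a) ≤ ι (isAssignedTo M b₁ a) + ι (is x a)
      balance-b₁ a with role a
      ... | mover refl e = indicators≤ (assigned-here M' e) dropped-x
                             (assigned-elsewhere M Mx (b₁≢b₂ ∘ sym)) (is-self x) ≤-refl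
      ... | taker refl e = indicators≤ (assigned-elsewhere M' e (b₁≢b₂ ∘ sym)) dropped-y
                             (assigned-elsewhere M My b₃≢b₁) (is-other (x≢y ∘ sym)) ≤-refl
      ... | dropout a≢x _ d e = indicators≤ (unassigned M' e) d
                                  (assigned-here M (dropped-hold-b₁ a d)) (is-other a≢x) ≤-refl
      ... | bystander a≢x _ d e = indicators≤ (assigned-agree M' M e) d refl (is-other a≢x) ≤-refl

      balance-b₂ : ∀ a → ι (isAssignedTo M' b₂ a) + ι (is x a) ≤ ι (isAssignedTo M b₂ a) + ι (is y a)
      balance-b₂ a with role a
      ... | mover refl e = indicators≤ (assigned-elsewhere M' e b₁≢b₂) (is-self x)
                             (assigned-here M Mx) (is-other x≢y) ≤-refl
      ... | taker refl e = indicators≤ (assigned-here M' e) (is-other (x≢y ∘ sym))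
                             (assigned-elsewhere M My (b₂≢b₃ ∘ sym)) (is-self y) ≤-refl
      ... | dropout a≢x a≢y d e = indicators≤ (unassigned M' e) (is-other a≢x)
                                    (assigned-elsewhere M (dropped-hold-b₁ a d) b₁≢b₂) (is-other a≢y) ≤-refl
      ... | bystander a≢x a≢y _ e = indicators≤ (assigned-agree M' M e) (is-other a≢x) refl (is-other a≢y) ≤-refl

      balance-other : ∀ {c} → c ≢ b₁ → c ≢ b₂ → ∀ a → ι (isAssignedTo M' c a) ≤ ι (isAssignedTo M c a)
      balance-other c≢b₁ c≢b₂ a with role a
      ... | mover _ e = indicator≤ (assigned-elsewhere M' e (c≢b₁ ∘ sym)) refl z≤n
      ... | taker _ e = indicator≤ (assigned-elsewhere M' e (c≢b₂ ∘ sym)) refl z≤n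
      ... | dropout _ _ _ e = indicator≤ (unassigned M' e) refl z≤n
      ... | bystander _ _ _ e = indicator≤ (assigned-agree M' M e) refl ≤-refl

      capacity' : ∀ c → count (isAssignedTo M' c) ≤ copies c
      capacity' c with c ≟ b₁ | c ≟ b₂
      ... | yes refl | _ = +-cancelʳ-≤ (count dropped) _ _ (begin
        count (isAssignedTo M' c) + count dropped ≤⟨ count-mono₂ balance-b₁ ⟩
        count (isAssignedTo M c) + count (is x)   ≡⟨ cong (count (isAssignedTo M c) +_) (count-is x) ⟩
        count (isAssignedTo M c) + 1              ≡⟨ +-comm _ 1 ⟩
        suc (count (isAssignedTo M c))            ≤⟨ room ⟩
        copies c + count dropped                  ∎)
        where open ≤-Reasoning
      ... | no _ | yes refl = +-cancelʳ-≤ 1 _ _ (begin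
        count (isAssignedTo M' c) + 1             ≡⟨ cong (count (isAssignedTo M' c) +_) (sym (count-is x)) ⟩
        count (isAssignedTo M' c) + count (is x)  ≤⟨ count-mono₂ balance-b₂ ⟩
        count (isAssignedTo M c) + count (is y)   ≡⟨ cong (count (isAssignedTo M c) +_) (count-is y) ⟩
        count (isAssignedTo M c) + 1              ≤⟨ +-monoˡ-≤ 1 (capacity c) ⟩
        copies c + 1                              ∎)
        where open ≤-Reasoning
      ... | no c≢b₁ | no c≢b₂ = ≤-trans (count-mono (balance-other c≢b₁ c≢b₂)) (capacity c)

      matching' : IsMatching M'
      matching' = record { acceptable = acceptable' ; capacity = capacity' }

      x-gains : prefers x M' M ≡ true
      x-gains = trans (prefers-just M' M M'x Mx) (<ᵇ-true (proj₂ x-ranks))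

      y-gains : prefers y M' M ≡ true
      y-gains = trans (prefers-just M' M M'y My) (<ᵇ-true (proj₂ y-ranks))

      only-dropped-lose : ∀ a → ι (prefers a M M') ≤ ι (dropped a)
      only-dropped-lose a with role a
      ... | mover refl e =
        indicator≤ (trans (prefers-just M M' Mx e) (<ᵇ-false (<⇒≯ (proj₂ x-ranks)))) refl z≤n
      ... | taker refl e =
        indicator≤ (trans (prefers-just M M' My e) (<ᵇ-false (<⇒≯ (proj₂ y-ranks)))) refl z≤n
      ... | dropout _ _ d _ = indicator≤ refl d (ι≤1 _)
      ... | bystander _ _ _ e = indicator≤ (prefers-same M M' (sym e)) refl z≤n

      more-popular : MorePopular M' M
      more-popular =
        ≤-trans (s≤s (≤-trans (count-mono only-dropped-lose) few-dropped)) (count-two x≢y x-gains y-gains)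

      refuted : ⊥
      refuted = noBetter M' matching' more-popular

    -- If b₁ has a free copy nobody is dropped, otherwise one holder of b₁ is.
    no-promotion : ∀ {x y b₁ b₂ b₃} → M x ≡ just b₂ → M y ≡ just b₃ → b₃ ≢ b₁ →
                   RanksAbove x b₁ b₂ → RanksAbove y b₂ b₃ → ⊥
    no-promotion {b₁ = b₁} Mx My b₃≢b₁ x-ranks y-ranks with m≤n⇒m<n∨m≡n (capacity b₁)
    ... | inj₁ b₁-free =
      Promotion.refuted Mx My b₃≢b₁ x-ranks y-ranks (λ _ → false) (λ _ ()) nobody-dropped room
      where
      nobody-dropped : count (λ _ → false) ≤ 1
      nobody-dropped = subst (_≤ 1) (sym count-none) z≤n
      room : suc (count (isAssignedTo M b₁)) ≤ copies b₁ + count (λ _ → false)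
      room = subst (suc (count (isAssignedTo M b₁)) ≤_)
               (sym (trans (cong (copies b₁ +_) count-none) (+-identityʳ _))) b₁-free
    ... | inj₂ b₁-full with count-witness (subst (1 ≤_) (sym b₁-full) (present (proj₁ x-ranks)))
    ...   | holder , holds =
      Promotion.refuted Mx My b₃≢b₁ x-ranks y-ranks (is holder) holder-holds-b₁ (≤-reflexive (count-is holder)) room
      where
      holder-holds-b₁ : ∀ a → is holder a ≡ true → M a ≡ just b₁
      holder-holds-b₁ a a-is-holder =
        subst (λ z → M z ≡ just b₁) (sym (is-sound a-is-holder)) (assigned-sound M holds)
      room : suc (count (isAssignedTo M b₁)) ≤ copies b₁ + count (is holder)
      room = ≤-reflexive (begin
        suc (count (isAssignedTo M b₁)) ≡⟨ cong suc b₁-full ⟩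
        suc (copies b₁)                 ≡⟨ +-comm 1 (copies b₁) ⟩
        copies b₁ + 1                   ≡⟨ cong (copies b₁ +_) (sym (count-is holder)) ⟩
        copies b₁ + count (is holder)   ∎)
        where open ≡-Reasoning

five≤ : ∀ {c₁ c₂ c₃} → 1 ≤ c₁ → 1 ≤ c₂ → 1 ≤ c₃ →
        2 ≤ c₁ ⊎ 2 ≤ c₂ → 2 ≤ c₂ ⊎ 2 ≤ c₃ → 2 ≤ c₁ ⊎ 2 ≤ c₃ → 5 ≤ c₁ + c₂ + c₃
five≤ h₁ h₂ h₃ (inj₁ d₁) (inj₁ d₂) _ = +-mono-≤ (+-mono-≤ d₁ d₂) h₃
five≤ h₁ h₂ h₃ (inj₁ d₁) (inj₂ d₃) _ = +-mono-≤ (+-mono-≤ d₁ h₂) d₃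
five≤ h₁ h₂ h₃ (inj₂ d₂) _ (inj₁ d₁) = +-mono-≤ (+-mono-≤ d₁ d₂) h₃
five≤ h₁ h₂ h₃ (inj₂ d₂) _ (inj₂ d₃) = +-mono-≤ (+-mono-≤ h₁ d₂) d₃

gadget-sum : (w : Fin 9 → ℕ) →
             ∑ (allFin 9) w ≡
             w (# 0) + w (# 1) + w (# 2) + ((w (# 3) + w (# 6)) + (w (# 4) + w (# 7)) + (w (# 5) + w (# 8)))
gadget-sum w = solve 9 (λ a₁ a₂ a₃ a₄ a₅ a₆ a₇ a₈ a₉ →
                 a₁ :+ (a₂ :+ (a₃ :+ (a₄ :+ (a₅ :+ (a₆ :+ (a₇ :+ (a₈ :+ (a₉ :+ con 0))))))))
                 := a₁ :+ a₂ :+ a₃ :+ ((a₄ :+ a₇) :+ (a₅ :+ a₈) :+ (a₆ :+ a₉)))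
               refl (w (# 0)) (w (# 1)) (w (# 2)) (w (# 3)) (w (# 4)) (w (# 5)) (w (# 6)) (w (# 7)) (w (# 8))
  where open +-*-Solver

-- The instances built from a monotone 1-in-3 SAT formula

_≟ᴾ_ : ∀ {m} → DecidableEquality (Person m)
_≟ᴾ_ = ≡-dec _≟F_ _≟F_

allPeople-unique : ∀ m → Unique (allPeople m)
allPeople-unique m = Unique.cartesianProduct⁺ (Unique.allFin⁺ m) (Unique.allFin⁺ 9)

allPeople-complete : ∀ {m} (a : Person m) → a ∈ allPeople m
allPeople-complete (i , k) = ∈-cartesianProduct⁺ (∈-allFin i) (∈-allFin k)

gadgetItems : ∀ {n m} → Fin m → List (Item n m)
gadgetItems i = map (p i) (allFin 3) ++ (q i ∷ [])

allItems-complete : ∀ {n m} (c : Item n m) → c ∈ allItems n m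
allItems-complete (u j) = ∈-++⁺ˡ (∈-map⁺ u (∈-allFin j))
allItems-complete {n} {m} (p i t) =
  ∈-++⁺ʳ (map u (allFin n)) (∈-concatMap⁺ (gadgetItems {n} {m})
    (Any.map (λ { refl → ∈-++⁺ˡ (∈-map⁺ (p i) (∈-allFin t)) }) (∈-allFin i)))
allItems-complete {n} {m} (q i) =
  ∈-++⁺ʳ (map u (allFin n)) (∈-concatMap⁺ (gadgetItems {n} {m})
    (Any.map (λ { refl → ∈-++⁺ʳ (map (p i) (allFin 3)) (here refl) }) (∈-allFin i)))

module Gadget {n m : ℕ} (C : Fin m → Clause n) (copies : Item n m → ℕ) where
  open PopularDefs _≟I_ (allPeople m) (prefsOf C) copies
  open PopularFacts _≟I_ _≟ᴾ_ (allPeople m) (allPeople-unique m) allPeople-complete (prefsOf C) copies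

  module _ {M : Person m → Maybe (Item n m)} (popular : IsPopular M) (perfect : Perfect M) where
    open IsPopular popular using (matching)

    paid : Person m → ℕ
    paid a = price cost (M a)

    paid-as : ∀ {a c} → M a ≡ just c → paid a ≡ cost c
    paid-as = cong (price cost)

    variable-person : ∀ a {j j'} → prefsOf C a ≡ u j ∷ u j' ∷ [] →
                      paid a ≡ 3 × (1 ≤ copies (u j) ⊎ 1 ≤ copies (u j'))
    variable-person a pa with two-choices matching perfect pa
    ... | inj₁ (Ma , u-present) = paid-as Ma , inj₁ u-present
    ... | inj₂ (Ma , u-present) = paid-as Ma , inj₂ u-present

    pair-positive : ∀ x y {i t j} → prefsOf C x ≡ u j ∷ p i t ∷ [] → 1 ≤ paid x + paid y
    pair-positive x y px with two-choices matching perfect px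
    ... | inj₁ (Mx , _) = ≤-trans (subst (1 ≤_) (sym (paid-as Mx)) (s≤s z≤n)) (m≤m+n _ _)
    ... | inj₂ (Mx , _) = ≤-trans (subst (1 ≤_) (sym (paid-as Mx)) (s≤s z≤n)) (m≤m+n _ _)

    -- ... and at least 2 when u_j is present, as x holding p_t and y holding q
    -- would be a promotion chain u_j, p_t, q
    pair-bound : ∀ x y {i t j} → prefsOf C x ≡ u j ∷ p i t ∷ [] → prefsOf C y ≡ p i t ∷ q i ∷ [] →
                 1 ≤ copies (u j) → 2 ≤ paid x + paid y
    pair-bound x y px py u-present with two-choices matching perfect px | two-choices matching perfect py
    ... | inj₁ (Mx , _) | _ = ≤-trans (subst (2 ≤_) (sym (paid-as Mx)) (s≤s (s≤s z≤n))) (m≤m+n _ _)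
    ... | inj₂ (Mx , _) | inj₁ (My , _) = ≤-reflexive (sym (cong₂ _+_ (paid-as Mx) (paid-as My)))
    ... | inj₂ (Mx , p-present) | inj₂ (My , q-present) =
      ⊥-elim (no-promotion popular Mx My (λ ())
               (top-two px u-present p-present (λ ())) (top-two py p-present q-present (λ ())))

    clause-bound : ∀ i → 14 ≤ ∑ (allFin 9) (λ k → paid (i , k))
    clause-bound i = begin
      14                                              ≤⟨ +-monoʳ-≤ 9 pairs-pay-5 ⟩
      3 + 3 + 3 + (c₁ + c₂ + c₃)                      ≡⟨ cong (_+ (c₁ + c₂ + c₃)) variables-pay-9 ⟩
      paid a₁ + paid a₂ + paid a₃ + (c₁ + c₂ + c₃)    ≡⟨ sym (gadget-sum (λ k → paid (i , k))) ⟩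
      ∑ (allFin 9) (λ k → paid (i , k))               ∎
      where
      open ≤-Reasoning
      a₁ a₂ a₃ : Person m
      a₁ = i , # 0
      a₂ = i , # 1
      a₃ = i , # 2
      v₁ = variable-person a₁ refl
      v₂ = variable-person a₂ refl
      v₃ = variable-person a₃ refl
      variables-pay-9 : 3 + 3 + 3 ≡ paid a₁ + paid a₂ + paid a₃
      variables-pay-9 = sym (cong₂ _+_ (cong₂ _+_ (proj₁ v₁) (proj₁ v₂)) (proj₁ v₃))
      c₁ c₂ c₃ : ℕ
      c₁ = paid (i , # 3) + paid (i , # 6)
      c₂ = paid (i , # 4) + paid (i , # 7)
      c₃ = paid (i , # 5) + paid (i , # 8)
      pair₁ = pair-bound (i , # 3) (i , # 6) refl refl
      pair₂ = pair-bound (i , # 4) (i , # 7) refl refl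
      pair₃ = pair-bound (i , # 5) (i , # 8) refl refl
      pairs-pay-5 : 5 ≤ c₁ + c₂ + c₃
      pairs-pay-5 = five≤ (pair-positive (i , # 3) (i , # 6) refl) (pair-positive (i , # 4) (i , # 7) refl)
                          (pair-positive (i , # 5) (i , # 8) refl)
                          (Sum.map pair₁ pair₂ (proj₂ v₁)) (Sum.map pair₂ pair₃ (proj₂ v₂))
                          (Sum.map pair₁ pair₃ (proj₂ v₃))

    people-bound : 14 * m ≤ ∑ (allPeople m) paid
    people-bound = begin
      14 * m                                                  ≡⟨ cong (14 *_) (sym (length-tabulate {n = m} id)) ⟩
      14 * length (allFin m)                                  ≤⟨ ∑-lower (allFin m) _ 14 clause-bound ⟩
      ∑ (allFin m) (λ i → ∑ (allFin 9) (λ k → paid (i , k)))  ≡⟨ sym (∑-cartesian (allFin m) (allFin 9) paid) ⟩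
      ∑ (allPeople m) paid                                    ∎
      where open ≤-Reasoning

    cost-bound : ∑ (allPeople m) paid ≤ instanceCost n m copies
    cost-bound = price-bound matching (allItems n m) allItems-complete cost

-- The theorem

lemma2 : (n m : ℕ) (C : Fin m → Clause n) → (∀ i → DistinctClause (C i)) →
         (copies : Item n m → ℕ) → AdmitsPerfectPopular n m C copies →
         14 * m ≤ instanceCost n m copies
lemma2 n m C _ copies (M , popular , perfect) =
  ≤-trans (people-bound popular perfect) (cost-bound popular perfect)
  where open Gadget C copies
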